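{- Let $s,\ell\in\mathbb{Z}_{\geqslant0}$, let $\mathcal{Q}_d$ be a prime polynomial in $\mathbb{F}_q[T]$ of degree $d$, and suppose $0\leqslant \ell<d$. Let $F_0=1$ and $F_i=(-1)^i+[i]F_{i-1}$ for $i\geqslant1$, where $[i]=T^{q^i}-T$. Then $F_{sd+\ell}\equiv(-1)^{sd}F_\ell \pmod{\mathcal{Q}_d}$.
   Context: $q$ is a prime power, $\mathbb{F}_q[T]$ the polynomial ring over the finite field $\mathbb{F}_q$; a prime polynomial is a monic irreducible polynomial. -}

module Defs where

open import Level using (Level; _⊔_)
open import Data.Nat using (ℕ; zero; suc; _<_; _^_)
open import Data.Fin using (Fin)
open import Data.List using (List; []; _∷_; map)
open import Data.Product using (Σ; ∃; _×_; _,_)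
open import Data.Sum using (_⊎_)
open import Relation.Nullary using (¬_)
open import Relation.Binary.PropositionalEquality using (_≡_)
open import Algebra.Bundles using (CommutativeRing)

record IsFiniteField {c ℓ : Level} (R : CommutativeRing c ℓ) (q : ℕ) : Set (c ⊔ ℓ) where
  open CommutativeRing R
  field
    one≉zero : ¬ (1# ≈ 0#)
    inverse  : ∀ x → ¬ (x ≈ 0#) → ∃ λ y → x * y ≈ 1#
    enum     : Fin q → Carrier
    enum-surj : ∀ x → ∃ λ i → enum i ≈ x
    enum-inj  : ∀ i j → enum i ≈ enum j → i ≡ j

-- Polynomials R[T] over a commutative ring, as coefficient lists
-- (constant coefficient first), compared coefficientwise.
module Poly {c ℓ : Level} (R : CommutativeRing c ℓ) where
  open CommutativeRing R

  Pol : Set c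
  Pol = List Carrier

  coeff : Pol → ℕ → Carrier
  coeff []      _       = 0#
  coeff (a ∷ p) zero    = a
  coeff (a ∷ p) (suc n) = coeff p n

  infix 4 _≈P_
  _≈P_ : Pol → Pol → Set ℓ
  p ≈P r = ∀ n → coeff p n ≈ coeff r n

  infixl 6 _+P_ _-P_
  infixl 7 _*P_

  _+P_ : Pol → Pol → Pol
  []      +P r       = r
  (a ∷ p) +P []      = a ∷ p
  (a ∷ p) +P (b ∷ r) = (a + b) ∷ (p +P r)

  -P_ : Pol → Pol
  -P p = map (-_) p

  _-P_ : Pol → Pol → Pol
  p -P r = p +P (-P r)

  _·P_ : Carrier → Pol → Pol
  a ·P p = map (a *_) p

  _*P_ : Pol → Pol → Pol
  []      *P r = []
  (a ∷ p) *P r = (a ·P r) +P (0# ∷ (p *P r))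

  constP : Carrier → Pol
  constP a = a ∷ []

  oneP : Pol
  oneP = constP 1#

  T : Pol
  T = 0# ∷ 1# ∷ []

  _^P_ : Pol → ℕ → Pol
  p ^P zero  = oneP
  p ^P suc n = p *P (p ^P n)

  sgn : ℕ → Pol
  sgn zero    = oneP
  sgn (suc i) = -P (sgn i)

  HasDegree : Pol → ℕ → Set ℓ
  HasDegree p d = ¬ (coeff p d ≈ 0#) × (∀ n → d < n → coeff p n ≈ 0#)

  IsMonic : Pol → ℕ → Set ℓ
  IsMonic p d = HasDegree p d × coeff p d ≈ 1#

  IsUnit : Pol → Set (c ⊔ ℓ)
  IsUnit p = ∃ λ r → p *P r ≈P oneP

  IsIrreducible : Pol → Set (c ⊔ ℓ)
  IsIrreducible p = ¬ (p ≈P []) × ¬ IsUnit p ×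
                    (∀ a b → p ≈P a *P b → IsUnit a ⊎ IsUnit b)

  IsPrimePolyOfDegree : Pol → ℕ → Set (c ⊔ ℓ)
  IsPrimePolyOfDegree p d = IsMonic p d × IsIrreducible p

  _≡_mod_ : Pol → Pol → Pol → Set (c ⊔ ℓ)
  a ≡ b mod m = ∃ λ k → a -P b ≈P k *P m

  module Carlitz (q : ℕ) where
    brk : ℕ → Pol
    brk i = (T ^P (q ^ i)) -P T

    F : ℕ → Pol
    F zero    = oneP
    F (suc i) = sgn (suc i) +P (brk (suc i) *P F i)

-- Modulo a prime Q of degree d, the residues of degree < d form a field with
-- q^d elements, so Fermat's little theorem gives T^(q^d) ≡ T (mod Q).  Hence
-- [i] = T^(q^i) - T is periodic in i with period d and [sd] ≡ [0] = 0.  The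
-- recursion F_i = (-1)^i + [i] F_(i-1) then gives F_(sd) ≡ (-1)^(sd), and
-- F_(sd+ℓ) ≡ (-1)^(sd) F_ℓ by induction on ℓ.
module Submission where

open import Defs
open import Level using (Level; _⊔_)
open import Algebra.Bundles using (CommutativeRing)
open import Algebra.Structures using (IsCommutativeRing)
open import Data.Nat as ℕ using (ℕ; zero; suc; _≤_; _<_; z≤n; s≤s)
open import Data.Nat.Properties as ℕ using (_≤?_; ≰⇒>; ≤-trans; <-trans; m≤n+m; m≤n⇒m<n∨m≡n)
open import Data.Nat.Induction using (<-wellFounded)
open import Data.Fin as Fin using (Fin)
open import Data.Fin.Properties using (punchInᵢ≢i)
open import Data.List using ([]; _∷_)
open import Data.Vec using (Vec; []; _∷_)
open import Data.Vec.Recursive using (Fin[m^n]↔Fin[m]^n)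
open import Data.Vec.Recursive.Properties using (↔Vec)
open import Data.Product using (∃; _×_; _,_; proj₁; proj₂)
open import Data.Sum using (_⊎_; inj₁; inj₂)
open import Function.Bundles using (Inverse; _↔_; mk↔ₛ′)
open import Function.Properties.Inverse using (↔-trans)
open import Induction.WellFounded using (Acc; acc)
open import Relation.Binary.Definitions using (Decidable)
open import Relation.Binary.PropositionalEquality as ≡ using (_≡_; _≢_)
open import Relation.Nullary using (¬_; yes; no; contradiction)

module PrincipalQuotient {c ℓ : Level} (S : CommutativeRing c ℓ) (m : CommutativeRing.Carrier S) where
  open CommutativeRing S
  open import Algebra.Properties.Ring ring
  open import Algebra.Properties.CommutativeSemigroup +-commutativeSemigroup using (interchange)
  open import Relation.Binary.Reasoning.Setoid setoid

  infix 4 _∼_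
  infix 5 _by_
  record _∼_ (a b : Carrier) : Set (c ⊔ ℓ) where
    constructor _by_
    field
      quotient : Carrier
      difference : a - b ≈ quotient * m
  open _∼_ public

  ≈⇒∼ : ∀ {a b} → a ≈ b → a ∼ b
  ≈⇒∼ a≈b = 0# by trans (x≈y⇒x∙y⁻¹≈ε a≈b) (sym (zeroˡ m))

  m∼0 : m ∼ 0#
  m∼0 = 1# by trans (trans (+-congˡ -0#≈0#) (+-identityʳ m)) (sym (*-identityˡ m))

  ∼-sym : ∀ {a b} → a ∼ b → b ∼ a
  ∼-sym {a} {b} (k by a-b≈km) = - k by (begin
    b - a     ≈⟨ ⁻¹-anti-homo‿- a b ⟨
    - (a - b) ≈⟨ -‿cong a-b≈km ⟩
    - (k * m) ≈⟨ -‿distribˡ-* k m ⟩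
    - k * m   ∎)

  -‿cong-∼ : ∀ {a b} → a ∼ b → - a ∼ - b
  -‿cong-∼ {a} {b} (k by a-b≈km) = - k by (begin
    - a - - b ≈⟨ -‿+-comm a (- b) ⟩
    - (a - b) ≈⟨ -‿cong a-b≈km ⟩
    - (k * m) ≈⟨ -‿distribˡ-* k m ⟩
    - k * m   ∎)

  +-cong-∼ : ∀ {a a′ b b′} → a ∼ a′ → b ∼ b′ → a + b ∼ a′ + b′
  +-cong-∼ {a} {a′} {b} {b′} (k by e) (k′ by e′) = k + k′ by (begin
    (a + b) - (a′ + b′)     ≈⟨ +-congˡ (-‿+-comm a′ b′) ⟨
    (a + b) + (- a′ + - b′) ≈⟨ interchange a b (- a′) (- b′) ⟩
    (a - a′) + (b - b′)     ≈⟨ +-cong e e′ ⟩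
    k * m + k′ * m          ≈⟨ distribʳ m k k′ ⟨
    (k + k′) * m            ∎)

  [x-y]+[y-z]≈x-z : ∀ x y z → (x - y) + (y - z) ≈ x - z
  [x-y]+[y-z]≈x-z x y z = begin
    (x - y) + (y - z) ≈⟨ +-assoc x (- y) (y - z) ⟩
    x + (- y + (y - z)) ≈⟨ +-congˡ (+-assoc (- y) y (- z)) ⟨
    x + ((- y + y) - z) ≈⟨ +-congˡ (+-congʳ (-‿inverseˡ y)) ⟩
    x + (0# - z)        ≈⟨ +-congˡ (+-identityˡ (- z)) ⟩
    x - z               ∎

  ∼-trans : ∀ {a b e} → a ∼ b → b ∼ e → a ∼ e
  ∼-trans {a} {b} {e} (k by a-b≈km) (k′ by b-e≈k′m) = k + k′ by (begin
    a - e               ≈⟨ [x-y]+[y-z]≈x-z a b e ⟨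
    (a - b) + (b - e)   ≈⟨ +-cong a-b≈km b-e≈k′m ⟩
    k * m + k′ * m      ≈⟨ distribʳ m k k′ ⟨
    (k + k′) * m        ∎)

  *-cong-∼ : ∀ {a a′ b b′} → a ∼ a′ → b ∼ b′ → a * b ∼ a′ * b′
  *-cong-∼ {a} {a′} {b} {b′} (k by e) (k′ by e′) = k * b + a′ * k′ by (begin
    a * b - a′ * b′                         ≈⟨ [x-y]+[y-z]≈x-z (a * b) (a′ * b) (a′ * b′) ⟨
    (a * b - a′ * b) + (a′ * b - a′ * b′)   ≈⟨ +-cong ([y-z]x≈yx-zx b a a′) (x[y-z]≈xy-xz a′ b b′) ⟨
    (a - a′) * b + a′ * (b - b′)            ≈⟨ +-cong (*-congʳ e) (*-congˡ e′) ⟩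
    (k * m) * b + a′ * (k′ * m)             ≈⟨ +-cong (xy∙z≈xz∙y k b m) (*-assoc a′ k′ m) ⟨
    (k * b) * m + (a′ * k′) * m             ≈⟨ distribʳ m (k * b) (a′ * k′) ⟨
    (k * b + a′ * k′) * m                   ∎)
    where open import Algebra.Properties.CommutativeSemigroup *-commutativeSemigroup using (xy∙z≈xz∙y)

  isCommutativeRing-∼ : IsCommutativeRing _∼_ _+_ _*_ -_ 0# 1#
  isCommutativeRing-∼ = record
    { isRing = record
      { +-isAbelianGroup = record
        { isGroup = record
          { isMonoid = record
            { isSemigroup = record
              { isMagma = record
                { isEquivalence = record { refl = ≈⇒∼ refl ; sym = ∼-sym ; trans = ∼-trans }
                ; ∙-cong = +-cong-∼ }
              ; assoc = λ x y z → ≈⇒∼ (+-assoc x y z) }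
            ; identity = (λ x → ≈⇒∼ (+-identityˡ x)) , (λ x → ≈⇒∼ (+-identityʳ x)) }
          ; inverse = (λ x → ≈⇒∼ (-‿inverseˡ x)) , (λ x → ≈⇒∼ (-‿inverseʳ x))
          ; ⁻¹-cong = -‿cong-∼ }
        ; comm = λ x y → ≈⇒∼ (+-comm x y) }
      ; *-cong = *-cong-∼
      ; *-assoc = λ x y z → ≈⇒∼ (*-assoc x y z)
      ; *-identity = (λ x → ≈⇒∼ (*-identityˡ x)) , (λ x → ≈⇒∼ (*-identityʳ x))
      ; distrib = (λ x y z → ≈⇒∼ (distribˡ x y z)) , (λ x y z → ≈⇒∼ (distribʳ x y z)) }
    ; *-comm = λ x y → ≈⇒∼ (*-comm x y) }

  S/m : CommutativeRing c (c ⊔ ℓ)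
  S/m = record { isCommutativeRing = isCommutativeRing-∼ }

module Products {c ℓ : Level} (K : CommutativeRing c ℓ) where
  open CommutativeRing K
  open import Algebra.Properties.Semiring.Exp semiring using (_^_)
  open import Algebra.Properties.CommutativeMonoid.Sum *-commutativeMonoid public
    using () renaming (sum to product; sum-remove to product-remove; sum-cong-≋ to product-cong;
                       sum-permute to product-permute; ∑-distrib-+ to product-distrib; sum-replicate to product-replicate)
  open import Algebra.Properties.CommutativeSemigroup *-commutativeSemigroup using (interchange)
  open import Data.Vec.Functional using (Vector; removeAt)
  open import Relation.Binary.Reasoning.Setoid setoid

  Invertible : Carrier → Set _
  Invertible x = ∃ λ y → x * y ≈ 1#

  product-invertible : ∀ {n} (f : Vector Carrier n) → (∀ i → Invertible (f i)) → Invertible (product f)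
  product-invertible {zero} f inv = 1# , *-identityˡ 1#
  product-invertible {suc n} f inv with inv Fin.zero | product-invertible (λ i → f (Fin.suc i)) (λ i → inv (Fin.suc i))
  ... | y , fy≈1 | z , pz≈1 = y * z , (begin
    (f Fin.zero * product (λ i → f (Fin.suc i))) * (y * z) ≈⟨ interchange _ _ y z ⟩
    (f Fin.zero * y) * (product (λ i → f (Fin.suc i)) * z) ≈⟨ *-cong fy≈1 pz≈1 ⟩
    1# * 1#                                                ≈⟨ *-identityˡ 1# ⟩
    1#                                                     ∎)

  product-with-one-exception : ∀ {n} (f : Vector Carrier n) (i : Fin n) {a} → f i ≈ 1# →
                               (∀ j → j ≢ i → f j ≈ a) → product f * a ≈ a ^ n
  product-with-one-exception {suc n} f i {a} fi≈1 fj≈a = begin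
    product f * a                      ≈⟨ *-congʳ (product-remove f) ⟩
    (f i * product (removeAt f i)) * a ≈⟨ *-congʳ (*-cong fi≈1 rest≈aⁿ) ⟩
    (1# * a ^ n) * a                   ≈⟨ *-congʳ (*-identityˡ (a ^ n)) ⟩
    a ^ n * a                          ≈⟨ *-comm (a ^ n) a ⟩
    a ^ suc n                          ∎
    where
    rest≈aⁿ : product (removeAt f i) ≈ a ^ n
    rest≈aⁿ = trans (product-cong (λ j → fj≈a (Fin.punchIn i j) (punchInᵢ≢i i j))) (product-replicate n)

module FiniteField {c ℓ : Level} (K : CommutativeRing c ℓ) {N : ℕ} (isFF : IsFiniteField K N) where
  open CommutativeRing K
  open IsFiniteField isFF
  open import Algebra.Properties.Semiring.Exp semiring using (_^_; ^-congˡ)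
  open Products K
  open import Data.Vec.Functional using (Vector)
  open import Relation.Binary.Reasoning.Setoid setoid

  index : Carrier → Fin N
  index x = proj₁ (enum-surj x)

  enum-index : ∀ x → enum (index x) ≈ x
  enum-index x = proj₂ (enum-surj x)

  index-cong : ∀ {x y} → x ≈ y → index x ≡ index y
  index-cong {x} {y} x≈y = enum-inj _ _ (trans (enum-index x) (trans x≈y (sym (enum-index y))))

  index-enum : ∀ i → index (enum i) ≡ i
  index-enum i = enum-inj _ _ (enum-index (enum i))

  infix 4 _≟_
  _≟_ : Decidable _≈_
  x ≟ y with index x Fin.≟ index y
  ... | yes ix≡iy = yes (trans (sym (enum-index x)) (trans (reflexive (≡.cong enum ix≡iy)) (enum-index y)))
  ... | no ix≢iy = no (λ x≈y → ix≢iy (index-cong x≈y))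

  mulBy : Carrier → Fin N → Fin N
  mulBy a i = index (a * enum i)

  mulBy-inverse : ∀ {a b} → (∀ x → a * (b * x) ≈ x) → ∀ i → mulBy a (mulBy b i) ≡ i
  mulBy-inverse ab≈1 i = enum-inj _ _ (trans (enum-index _) (trans (*-congˡ (enum-index _)) (ab≈1 (enum i))))

  nonzeroOrOne : Carrier → Carrier
  nonzeroOrOne x with x ≟ 0#
  ... | yes _ = 1#
  ... | no _  = x

  nonzeroOrOne-cong : ∀ {x y} → x ≈ y → nonzeroOrOne x ≈ nonzeroOrOne y
  nonzeroOrOne-cong {x} {y} x≈y with x ≟ 0# | y ≟ 0#
  ... | yes _   | yes _   = refl
  ... | yes x≈0 | no y≉0  = contradiction (trans (sym x≈y) x≈0) y≉0
  ... | no x≉0  | yes y≈0 = contradiction (trans x≈y y≈0) x≉0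
  ... | no _    | no _    = x≈y

  nonzeroOrOne-invertible : ∀ x → Invertible (nonzeroOrOne x)
  nonzeroOrOne-invertible x with x ≟ 0#
  ... | yes _   = 1# , *-identityˡ 1#
  ... | no x≉0 = inverse x x≉0

  module _ (a : Carrier) (a≉0 : ¬ (a ≈ 0#)) where
    private
      b : Carrier
      b = proj₁ (inverse a a≉0)
      ab≈1 : a * b ≈ 1#
      ab≈1 = proj₂ (inverse a a≉0)

    b*a*x≈x : ∀ x → b * (a * x) ≈ x
    b*a*x≈x x = begin
      b * (a * x) ≈⟨ *-assoc b a x ⟨
      (b * a) * x ≈⟨ *-congʳ (trans (*-comm b a) ab≈1) ⟩
      1# * x      ≈⟨ *-identityˡ x ⟩
      x           ∎

    a*b*x≈x : ∀ x → a * (b * x) ≈ x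
    a*b*x≈x x = trans (sym (*-assoc a b x)) (trans (*-congʳ ab≈1) (*-identityˡ x))

    scale : Carrier → Carrier
    scale x with x ≟ 0#
    ... | yes _ = 1#
    ... | no _  = a

    nonzeroOrOne-* : ∀ x → nonzeroOrOne (a * x) ≈ scale x * nonzeroOrOne x
    nonzeroOrOne-* x with x ≟ 0# | (a * x) ≟ 0#
    ... | yes _   | yes _     = sym (*-identityˡ 1#)
    ... | yes x≈0 | no ax≉0   = contradiction (trans (*-congˡ x≈0) (zeroʳ a)) ax≉0
    ... | no x≉0  | yes ax≈0  = contradiction (trans (sym (b*a*x≈x x)) (trans (*-congˡ ax≈0) (zeroʳ b))) x≉0
    ... | no _    | no _      = refl

    scale-≈0 : ∀ {x} → x ≈ 0# → scale x ≈ 1#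
    scale-≈0 {x} x≈0 with x ≟ 0#
    ... | yes _   = refl
    ... | no x≉0 = contradiction x≈0 x≉0

    scale-≉0 : ∀ {x} → ¬ (x ≈ 0#) → scale x ≈ a
    scale-≉0 {x} x≉0 with x ≟ 0#
    ... | yes x≈0 = contradiction x≈0 x≉0
    ... | no _    = refl

    -- Multiplication by a permutes the elements, and the product of the
    -- nonzero elements is a unit, so the product of the scales is 1.
    product-scale≈1 : product (λ i → scale (enum i)) ≈ 1#
    product-scale≈1 = begin
      G                   ≈⟨ *-identityʳ G ⟨
      G * 1#              ≈⟨ *-congˡ Py≈1 ⟨
      G * (product P * y) ≈⟨ *-assoc G (product P) y ⟨
      (G * product P) * y ≈⟨ *-congʳ P≈G*P ⟨
      product P * y       ≈⟨ Py≈1 ⟩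
      1#                  ∎
      where
      P : Vector Carrier N
      P i = nonzeroOrOne (enum i)
      G : Carrier
      G = product (λ i → scale (enum i))
      y : Carrier
      y = proj₁ (product-invertible P (λ i → nonzeroOrOne-invertible (enum i)))
      Py≈1 : product P * y ≈ 1#
      Py≈1 = proj₂ (product-invertible P (λ i → nonzeroOrOne-invertible (enum i)))
      mulByA : Fin N ↔ Fin N
      mulByA = mk↔ₛ′ (mulBy a) (mulBy b) (mulBy-inverse a*b*x≈x) (mulBy-inverse b*a*x≈x)
      P≈G*P : product P ≈ G * product P
      P≈G*P = begin
        product P                                       ≈⟨ product-permute P mulByA ⟩
        product (λ i → nonzeroOrOne (enum (mulBy a i))) ≈⟨ product-cong (λ i → nonzeroOrOne-cong (enum-index (a * enum i))) ⟩
        product (λ i → nonzeroOrOne (a * enum i))       ≈⟨ product-cong (λ i → nonzeroOrOne-* (enum i)) ⟩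
        product (λ i → scale (enum i) * P i)            ≈⟨ product-distrib _ P ⟩
        G * product P                                   ∎

    fermat-≉0 : a ^ N ≈ a
    fermat-≉0 = begin
      a ^ N                               ≈⟨ product-with-one-exception (λ i → scale (enum i)) (index 0#)
                                               (scale-≈0 (enum-index 0#)) (λ j j≢i → scale-≉0 (enum≉0 j j≢i)) ⟨
      product (λ i → scale (enum i)) * a ≈⟨ *-congʳ product-scale≈1 ⟩
      1# * a                              ≈⟨ *-identityˡ a ⟩
      a                                   ∎
      where
      enum≉0 : ∀ j → j ≢ index 0# → ¬ (enum j ≈ 0#)
      enum≉0 j j≢i0 ej≈0 = j≢i0 (≡.trans (≡.sym (index-enum j)) (index-cong ej≈0))

  fermat : ∀ x → x ^ N ≈ x
  fermat x with x ≟ 0#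
  ... | no x≉0  = fermat-≉0 x x≉0
  ... | yes x≈0 = trans (^-congˡ N x≈0) (trans (0^n≈0 (index 0#)) (sym x≈0))
    where
    0^n≈0 : ∀ {n} → Fin n → 0# ^ n ≈ 0#
    0^n≈0 {suc n} _ = zeroˡ (0# ^ n)

module PolynomialRing {c ℓ : Level} (R : CommutativeRing c ℓ) where
  open CommutativeRing R hiding (zero)
  open Poly R
  open import Algebra.Properties.Ring ring using (-0#≈0#)
  open import Algebra.Properties.CommutativeSemigroup +-commutativeSemigroup using (interchange)
  open import Relation.Binary.Reasoning.Setoid setoid

  -- _≈P_ wrapped in a record, so that its arguments can be inferred.
  infix 4 _≋_
  record _≋_ (p r : Pol) : Set ℓ where
    constructor mk
    field at : p ≈P r
  open _≋_ public

  ≋-refl : ∀ {p} → p ≋ p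
  ≋-refl = mk λ n → refl

  ≋-sym : ∀ {p r} → p ≋ r → r ≋ p
  ≋-sym p≋r = mk λ n → sym (at p≋r n)

  ≋-trans : ∀ {p r s} → p ≋ r → r ≋ s → p ≋ s
  ≋-trans p≋r r≋s = mk λ n → trans (at p≋r n) (at r≋s n)

  coeff-+P : ∀ p r n → coeff (p +P r) n ≈ coeff p n + coeff r n
  coeff-+P []      r       n       = sym (+-identityˡ _)
  coeff-+P (a ∷ p) []      n       = sym (+-identityʳ _)
  coeff-+P (a ∷ p) (b ∷ r) zero    = refl
  coeff-+P (a ∷ p) (b ∷ r) (suc n) = coeff-+P p r n

  coeff--P : ∀ p n → coeff (-P p) n ≈ - coeff p n
  coeff--P []      n       = sym -0#≈0#
  coeff--P (a ∷ p) zero    = refl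
  coeff--P (a ∷ p) (suc n) = coeff--P p n

  coeff-·P : ∀ a p n → coeff (a ·P p) n ≈ a * coeff p n
  coeff-·P a []      n       = sym (zeroʳ a)
  coeff-·P a (b ∷ p) zero    = refl
  coeff-·P a (b ∷ p) (suc n) = coeff-·P a p n

  ∷-cong : ∀ {a b p r} → a ≈ b → p ≋ r → a ∷ p ≋ b ∷ r
  ∷-cong a≈b p≋r = mk λ { zero → a≈b ; (suc n) → at p≋r n }

  ∷-injectiveʳ : ∀ {a b p r} → a ∷ p ≋ b ∷ r → p ≋ r
  ∷-injectiveʳ e = mk λ n → at e (suc n)

  0∷[]≋[] : 0# ∷ [] ≋ []
  0∷[]≋[] = mk λ { zero → refl ; (suc n) → refl }

  0∷-zero : ∀ {p} → p ≋ [] → 0# ∷ p ≋ []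
  0∷-zero p≋[] = ≋-trans (∷-cong refl p≋[]) 0∷[]≋[]

  +P-cong : ∀ {p p′ r r′} → p ≋ p′ → r ≋ r′ → p +P r ≋ p′ +P r′
  +P-cong {p} {p′} {r} {r′} p≋p′ r≋r′ = mk λ n → begin
    coeff (p +P r) n        ≈⟨ coeff-+P p r n ⟩
    coeff p n + coeff r n   ≈⟨ +-cong (at p≋p′ n) (at r≋r′ n) ⟩
    coeff p′ n + coeff r′ n ≈⟨ coeff-+P p′ r′ n ⟨
    coeff (p′ +P r′) n      ∎

  -P-cong : ∀ {p r} → p ≋ r → -P p ≋ -P r
  -P-cong {p} {r} p≋r = mk λ n → trans (coeff--P p n) (trans (-‿cong (at p≋r n)) (sym (coeff--P r n)))

  ·P-cong : ∀ {a b p r} → a ≈ b → p ≋ r → a ·P p ≋ b ·P r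
  ·P-cong {a} {b} {p} {r} a≈b p≋r =
    mk λ n → trans (coeff-·P a p n) (trans (*-cong a≈b (at p≋r n)) (sym (coeff-·P b r n)))

  +P-assoc : ∀ p r s → (p +P r) +P s ≋ p +P (r +P s)
  +P-assoc p r s = mk λ n → begin
    coeff ((p +P r) +P s) n             ≈⟨ coeff-+P (p +P r) s n ⟩
    coeff (p +P r) n + coeff s n        ≈⟨ +-congʳ (coeff-+P p r n) ⟩
    (coeff p n + coeff r n) + coeff s n ≈⟨ +-assoc _ _ _ ⟩
    coeff p n + (coeff r n + coeff s n) ≈⟨ +-congˡ (coeff-+P r s n) ⟨
    coeff p n + coeff (r +P s) n        ≈⟨ coeff-+P p (r +P s) n ⟨
    coeff (p +P (r +P s)) n             ∎

  +P-comm : ∀ p r → p +P r ≋ r +P p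
  +P-comm p r = mk λ n → trans (coeff-+P p r n) (trans (+-comm _ _) (sym (coeff-+P r p n)))

  +P-interchange : ∀ p r s t → (p +P r) +P (s +P t) ≋ (p +P s) +P (r +P t)
  +P-interchange p r s t = mk λ n → begin
    coeff ((p +P r) +P (s +P t)) n                    ≈⟨ coeff-+P (p +P r) (s +P t) n ⟩
    coeff (p +P r) n + coeff (s +P t) n               ≈⟨ +-cong (coeff-+P p r n) (coeff-+P s t n) ⟩
    (coeff p n + coeff r n) + (coeff s n + coeff t n) ≈⟨ interchange _ _ _ _ ⟩
    (coeff p n + coeff s n) + (coeff r n + coeff t n) ≈⟨ +-cong (coeff-+P p s n) (coeff-+P r t n) ⟨
    coeff (p +P s) n + coeff (r +P t) n               ≈⟨ coeff-+P (p +P s) (r +P t) n ⟨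
    coeff ((p +P s) +P (r +P t)) n                    ∎

  +P-identityʳ : ∀ p → p +P [] ≋ p
  +P-identityʳ p = mk λ n → trans (coeff-+P p [] n) (+-identityʳ _)

  -P-inverseˡ : ∀ p → (-P p) +P p ≋ []
  -P-inverseˡ p = mk λ n → trans (coeff-+P (-P p) p n) (trans (+-congʳ (coeff--P p n)) (-‿inverseˡ _))

  -P-inverseʳ : ∀ p → p +P (-P p) ≋ []
  -P-inverseʳ p = ≋-trans (+P-comm p (-P p)) (-P-inverseˡ p)

  +P-zero : ∀ {p r} → p ≋ [] → r ≋ [] → p +P r ≋ []
  +P-zero p≋[] r≋[] = ≋-trans (+P-cong p≋[] r≋[]) ≋-refl

  ·P-zeroˡ : ∀ {a} p → a ≈ 0# → a ·P p ≋ []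
  ·P-zeroˡ {a} p a≈0 = mk λ n → trans (coeff-·P a p n) (trans (*-congʳ a≈0) (zeroˡ _))

  ·P-distrib-+P : ∀ a p r → a ·P (p +P r) ≋ a ·P p +P a ·P r
  ·P-distrib-+P a p r = mk λ n → begin
    coeff (a ·P (p +P r)) n                 ≈⟨ coeff-·P a (p +P r) n ⟩
    a * coeff (p +P r) n                    ≈⟨ *-congˡ (coeff-+P p r n) ⟩
    a * (coeff p n + coeff r n)             ≈⟨ distribˡ _ _ _ ⟩
    a * coeff p n + a * coeff r n           ≈⟨ +-cong (coeff-·P a p n) (coeff-·P a r n) ⟨
    coeff (a ·P p) n + coeff (a ·P r) n     ≈⟨ coeff-+P (a ·P p) (a ·P r) n ⟨
    coeff (a ·P p +P a ·P r) n              ∎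

  ·P-assoc : ∀ a b p → a ·P (b ·P p) ≋ (a * b) ·P p
  ·P-assoc a b p = mk λ n → begin
    coeff (a ·P (b ·P p)) n ≈⟨ coeff-·P a (b ·P p) n ⟩
    a * coeff (b ·P p) n    ≈⟨ *-congˡ (coeff-·P b p n) ⟩
    a * (b * coeff p n)     ≈⟨ *-assoc _ _ _ ⟨
    (a * b) * coeff p n     ≈⟨ coeff-·P (a * b) p n ⟨
    coeff ((a * b) ·P p) n  ∎

  ·P-identity : ∀ p → 1# ·P p ≋ p
  ·P-identity p = mk λ n → trans (coeff-·P 1# p n) (*-identityˡ _)

  *P-zeroˡ : ∀ {p} r → p ≋ [] → p *P r ≋ []
  *P-zeroˡ {[]}    r p≋[] = ≋-refl
  *P-zeroˡ {a ∷ p} r a∷p≋[] =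
    +P-zero (·P-zeroˡ r (at a∷p≋[] zero)) (0∷-zero (*P-zeroˡ {p} r (mk λ n → at a∷p≋[] (suc n))))

  *P-zeroʳ : ∀ p → p *P [] ≋ []
  *P-zeroʳ []      = ≋-refl
  *P-zeroʳ (a ∷ p) = 0∷-zero (*P-zeroʳ p)

  *P-congˡ : ∀ {p p′} r → p ≋ p′ → p *P r ≋ p′ *P r
  *P-congˡ {[]}    {[]}     r p≋p′ = ≋-refl
  *P-congˡ {[]}    {b ∷ p′} r p≋p′ = ≋-sym (*P-zeroˡ r (≋-sym p≋p′))
  *P-congˡ {a ∷ p} {[]}     r p≋p′ = *P-zeroˡ r p≋p′
  *P-congˡ {a ∷ p} {b ∷ p′} r p≋p′ =
    +P-cong (·P-cong (at p≋p′ zero) ≋-refl) (∷-cong refl (*P-congˡ r (∷-injectiveʳ p≋p′)))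

  *P-congʳ : ∀ p {r r′} → r ≋ r′ → p *P r ≋ p *P r′
  *P-congʳ []      r≋r′ = ≋-refl
  *P-congʳ (a ∷ p) r≋r′ = +P-cong (·P-cong refl r≋r′) (∷-cong refl (*P-congʳ p r≋r′))

  *P-∷ʳ : ∀ p b r → p *P (b ∷ r) ≋ b ·P p +P (0# ∷ p *P r)
  *P-∷ʳ []      b r = ≋-sym 0∷[]≋[]
  *P-∷ʳ (a ∷ p) b r = ≋-trans (+P-cong {a ·P (b ∷ r)} ≋-refl (∷-cong refl (*P-∷ʳ p b r)))
    (∷-cong (+-congʳ (*-comm a b)) (swap (a ·P r) (b ·P p) (0# ∷ p *P r)))
    where
    swap : ∀ x y z → x +P (y +P z) ≋ y +P (x +P z)
    swap x y z = ≋-trans (≋-sym (+P-assoc x y z)) (≋-trans (+P-cong (+P-comm x y) ≋-refl) (+P-assoc y x z))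

  *P-comm : ∀ p r → p *P r ≋ r *P p
  *P-comm []      r = ≋-sym (*P-zeroʳ r)
  *P-comm (a ∷ p) r = ≋-trans (+P-cong (≋-refl {a ·P r}) (∷-cong refl (*P-comm p r))) (≋-sym (*P-∷ʳ r a p))

  ·P-*P : ∀ a p r → a ·P (p *P r) ≋ (a ·P p) *P r
  ·P-*P a []      r = ≋-refl
  ·P-*P a (b ∷ p) r = ≋-trans (·P-distrib-+P a (b ·P r) (0# ∷ p *P r))
    (+P-cong (·P-assoc a b r) (∷-cong (zeroʳ a) (·P-*P a p r)))

  *P-distribˡ : ∀ p r s → p *P (r +P s) ≋ p *P r +P p *P s
  *P-distribˡ []      r s = ≋-refl
  *P-distribˡ (a ∷ p) r s = ≋-trans
    (+P-cong (·P-distrib-+P a r s) (∷-cong (sym (+-identityˡ 0#)) (*P-distribˡ p r s)))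
    (+P-interchange (a ·P r) (a ·P s) (0# ∷ p *P r) (0# ∷ p *P s))

  *P-distribʳ : ∀ p r s → (r +P s) *P p ≋ r *P p +P s *P p
  *P-distribʳ p r s =
    ≋-trans (*P-comm (r +P s) p) (≋-trans (*P-distribˡ p r s) (+P-cong (*P-comm p r) (*P-comm p s)))

  *P-assoc : ∀ p r s → (p *P r) *P s ≋ p *P (r *P s)
  *P-assoc []      r s = ≋-refl
  *P-assoc (a ∷ p) r s = ≋-trans (*P-distribʳ s (a ·P r) (0# ∷ p *P r))
    (+P-cong (≋-sym (·P-*P a r s))
             (≋-trans (+P-cong (·P-zeroˡ s refl) ≋-refl) (∷-cong refl (*P-assoc p r s))))

  *P-identityˡ : ∀ p → oneP *P p ≋ p
  *P-identityˡ p = ≋-trans (+P-cong (·P-identity p) 0∷[]≋[]) (+P-identityʳ p)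

  *P-identityʳ : ∀ p → p *P oneP ≋ p
  *P-identityʳ p = ≋-trans (*P-comm p oneP) (*P-identityˡ p)

  R[T]-isCommutativeRing : IsCommutativeRing _≋_ _+P_ _*P_ -P_ [] oneP
  R[T]-isCommutativeRing = record
    { isRing = record
      { +-isAbelianGroup = record
        { isGroup = record
          { isMonoid = record
            { isSemigroup = record
              { isMagma = record
                { isEquivalence = record { refl = ≋-refl ; sym = ≋-sym ; trans = ≋-trans }
                ; ∙-cong = +P-cong }
              ; assoc = +P-assoc }
            ; identity = (λ p → ≋-refl) , +P-identityʳ }
          ; inverse = -P-inverseˡ , -P-inverseʳ
          ; ⁻¹-cong = -P-cong }
        ; comm = +P-comm }
      ; *-cong = λ {p} {p′} {r} e f → ≋-trans (*P-congˡ r e) (*P-congʳ p′ f)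
      ; *-assoc = *P-assoc
      ; *-identity = *P-identityˡ , *P-identityʳ
      ; distrib = *P-distribˡ , *P-distribʳ }
    ; *-comm = *P-comm }

  R[T] : CommutativeRing c ℓ
  R[T] = record { isCommutativeRing = R[T]-isCommutativeRing }

module PolynomialDivision {c ℓ : Level} (R : CommutativeRing c ℓ) where
  open CommutativeRing R hiding (zero)
  open Poly R
  open PolynomialRing R
  open import Algebra.Properties.Ring ring using (-0#≈0#)
  open import Relation.Binary.Reasoning.Setoid setoid

  DegreeBelow : ℕ → Pol → Set ℓ
  DegreeBelow e p = ∀ n → e ≤ n → coeff p n ≈ 0#

  HasDegree⇒DegreeBelow : ∀ {p e} → HasDegree p e → DegreeBelow (suc e) p
  HasDegree⇒DegreeBelow (_ , above-e≈0) n = above-e≈0 n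

  DegreeBelow⇒< : ∀ {p e e′} → DegreeBelow e p → HasDegree p e′ → e′ < e
  DegreeBelow⇒< {e = e} {e′} below (lead≉0 , _) with e ≤? e′
  ... | yes e≤e′ = contradiction (below e′ e≤e′) lead≉0
  ... | no e≰e′  = ≰⇒> e≰e′

  DegreeBelow-mono : ∀ {e e′ p} → e ≤ e′ → DegreeBelow e p → DegreeBelow e′ p
  DegreeBelow-mono e≤e′ below n e′≤n = below n (≤-trans e≤e′ e′≤n)

  DegreeBelow-0 : ∀ {p} → DegreeBelow 0 p → p ≋ []
  DegreeBelow-0 below = mk λ n → below n z≤n

  DegreeBelow--P : ∀ {e p r} → DegreeBelow e p → DegreeBelow e r → DegreeBelow e (p -P r)
  DegreeBelow--P {e} {p} {r} p-below r-below n e≤n = begin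
    coeff (p -P r) n                ≈⟨ coeff-+P p (-P r) n ⟩
    coeff p n + coeff (-P r) n      ≈⟨ +-cong (p-below n e≤n) (trans (coeff--P r n) (-‿cong (r-below n e≤n))) ⟩
    0# + - 0#                       ≈⟨ trans (+-identityˡ (- 0#)) -0#≈0# ⟩
    0#                              ∎

  record DivMod (g p : Pol) (e : ℕ) : Set (c ⊔ ℓ) where
    constructor divMod
    field
      quotient  : Pol
      remainder : Pol
      p≋gq+r    : p ≋ g *P quotient +P remainder
      remainder-below : DegreeBelow e remainder

  -- Long division, from the constant coefficient upwards: the remainder
  -- of (a ∷ p) is that of a + T·(remainder of p), reduced once by g.
  divide : ∀ {g e} → coeff g e ≈ 1# → DegreeBelow (suc e) g → ∀ p → DivMod g p e
  divide {g} {e} lead≈1 g-below [] =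
    divMod [] [] (≋-sym (≋-trans (+P-identityʳ (g *P [])) (*P-zeroʳ g))) (λ n _ → refl)
  divide {g} {e} lead≈1 g-below (a ∷ p) with divide {g} {e} lead≈1 g-below p
  ... | divMod h r p≋gh+r r-below = divMod (b ∷ h) (t -P b ·P g) a∷p≋ t-bg-below
    where
    t : Pol
    t = a ∷ r
    b : Carrier
    b = coeff t e
    a∷p≋ : a ∷ p ≋ g *P (b ∷ h) +P (t -P b ·P g)
    a∷p≋ = ≋-trans (∷-cong (sym (+-identityˡ a)) p≋gh+r)
             (≋-trans (add-and-subtract (0# ∷ g *P h) t (b ·P g))
               (+P-cong (≋-sym (*P-∷ʳ g b h)) ≋-refl))
      where
      open import Algebra.Properties.AbelianGroup (CommutativeRing.+-abelianGroup R[T]) using (xyx⁻¹≈y)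
      add-and-subtract : ∀ x t y → x +P t ≋ (y +P x) +P (t -P y)
      add-and-subtract x t y = ≋-sym (≋-trans (≋-sym (+P-assoc (y +P x) t (-P y)))
        (≋-trans (+P-cong (+P-assoc y x t) ≋-refl) (xyx⁻¹≈y y (x +P t))))

    coeff-t-bg : ∀ n → coeff (t -P b ·P g) n ≈ coeff t n - b * coeff g n
    coeff-t-bg n = trans (coeff-+P t (-P (b ·P g)) n) (+-congˡ (trans (coeff--P (b ·P g) n) (-‿cong (coeff-·P b g n))))

    t-bg-below : DegreeBelow e (t -P b ·P g)
    t-bg-below n e≤n with m≤n⇒m<n∨m≡n e≤n
    ... | inj₂ ≡.refl = begin
      coeff (t -P b ·P g) e  ≈⟨ coeff-t-bg e ⟩
      b - b * coeff g e      ≈⟨ +-congˡ (-‿cong (trans (*-congˡ lead≈1) (*-identityʳ b))) ⟩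
      b - b                  ≈⟨ -‿inverseʳ b ⟩
      0#                     ∎
    ... | inj₁ e<n = begin
      coeff (t -P b ·P g) n  ≈⟨ coeff-t-bg n ⟩
      coeff t n - b * coeff g n ≈⟨ +-cong (t-below n e<n) (-‿cong (trans (*-congˡ (g-below n e<n)) (zeroʳ b))) ⟩
      0# - 0#                ≈⟨ trans (+-identityˡ (- 0#)) -0#≈0# ⟩
      0#                     ∎
      where
      t-below : ∀ n → e < n → coeff t n ≈ 0#
      t-below (suc n) (s≤s e≤n) = r-below n e≤n

  coeff-*P-top : ∀ k e Q d → DegreeBelow (suc e) k → DegreeBelow (suc d) Q →
                 coeff (k *P Q) (e ℕ.+ d) ≈ coeff k e * coeff Q d
  coeff-*P-top []      e       Q d k-below Q-below = sym (zeroˡ _)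
  coeff-*P-top (a ∷ k) zero    Q d k-below Q-below = begin
    coeff (a ·P Q +P (0# ∷ k *P Q)) d        ≈⟨ coeff-+P (a ·P Q) (0# ∷ k *P Q) d ⟩
    coeff (a ·P Q) d + coeff (0# ∷ k *P Q) d ≈⟨ +-cong (coeff-·P a Q d) (at (0∷-zero (*P-zeroˡ {k} Q k≋[])) d) ⟩
    a * coeff Q d + 0#                       ≈⟨ +-identityʳ _ ⟩
    a * coeff Q d                            ∎
    where
    k≋[] : k ≋ []
    k≋[] = mk λ n → k-below (suc n) (s≤s z≤n)
  coeff-*P-top (a ∷ k) (suc e) Q d k-below Q-below = begin
    coeff (a ·P Q +P (0# ∷ k *P Q)) (suc (e ℕ.+ d))           ≈⟨ coeff-+P (a ·P Q) (0# ∷ k *P Q) _ ⟩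
    coeff (a ·P Q) (suc (e ℕ.+ d)) + coeff (k *P Q) (e ℕ.+ d) ≈⟨ +-cong aQ-top≈0 k*Q-top ⟩
    0# + coeff k e * coeff Q d                                ≈⟨ +-identityˡ _ ⟩
    coeff k e * coeff Q d                                     ∎
    where
    aQ-top≈0 : coeff (a ·P Q) (suc (e ℕ.+ d)) ≈ 0#
    aQ-top≈0 = trans (coeff-·P a Q _) (trans (*-congˡ (Q-below _ (s≤s (m≤n+m d e)))) (zeroʳ a))
    k*Q-top : coeff (k *P Q) (e ℕ.+ d) ≈ coeff k e * coeff Q d
    k*Q-top = coeff-*P-top k e Q d (λ n e<n → k-below (suc n) (s≤s e<n)) Q-below

  module _ (_≟_ : Decidable _≈_) where

    zero-or-degree : ∀ p → p ≋ [] ⊎ ∃ (HasDegree p)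
    zero-or-degree []      = inj₁ ≋-refl
    zero-or-degree (a ∷ p) with zero-or-degree p
    ... | inj₂ (e , lead≉0 , above≈0) = inj₂ (suc e , lead≉0 , λ { (suc n) (s≤s e<n) → above≈0 n e<n })
    ... | inj₁ p≋[] with a ≟ 0#
    ...   | yes a≈0 = inj₁ (≋-trans (∷-cong a≈0 p≋[]) 0∷[]≋[])
    ...   | no a≉0  = inj₂ (0 , a≉0 , λ { (suc n) _ → at p≋[] n })

    multiple-of-monic-below≈0 : ∀ {Q d r} k → IsMonic Q d → DegreeBelow d r → r ≋ k *P Q → r ≋ []
    multiple-of-monic-below≈0 {Q} {d} {r} k ((_ , Q-below) , lead≈1) r-below r≋kQ with zero-or-degree k
    ... | inj₁ k≋[]                     = ≋-trans r≋kQ (*P-zeroˡ Q k≋[])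
    ... | inj₂ (e , lead-k≉0 , k-below) = contradiction (begin
      coeff k e                 ≈⟨ *-identityʳ _ ⟨
      coeff k e * 1#            ≈⟨ *-congˡ lead≈1 ⟨
      coeff k e * coeff Q d     ≈⟨ coeff-*P-top k e Q d k-below Q-below ⟨
      coeff (k *P Q) (e ℕ.+ d)  ≈⟨ at r≋kQ (e ℕ.+ d) ⟨
      coeff r (e ℕ.+ d)         ≈⟨ r-below _ (m≤n+m d e) ⟩
      0#                        ∎) lead-k≉0

module ResidueField {c ℓ : Level} (q : ℕ) (R : CommutativeRing c ℓ) (isFF : IsFiniteField R q)
                    (d : ℕ) (Q : Poly.Pol R) (Q-prime : Poly.IsPrimePolyOfDegree R Q d) where
  open CommutativeRing R hiding (zero)
  open IsFiniteField isFF using (one≉zero; inverse; enum; enum-inj)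
  open FiniteField R isFF using (_≟_; index; enum-index)
  open Poly R
  open PolynomialRing R
  open PolynomialDivision R
  open PrincipalQuotient R[T] Q renaming (S/m to R[T]/Q)
  module K = CommutativeRing R[T]/Q
  open import Algebra.Properties.Group (CommutativeRing.+-group R[T]) using (x∙y⁻¹≈ε⇒x≈y; //-rightDividesʳ)
  open import Relation.Binary.Reasoning.Setoid K.setoid

  private
    Q-monic : IsMonic Q d
    Q-monic = proj₁ Q-prime
    Q-irreducible : IsIrreducible Q
    Q-irreducible = proj₂ Q-prime

  below-∼⇒≋ : ∀ {r s} → DegreeBelow d r → DegreeBelow d s → r ∼ s → r ≋ s
  below-∼⇒≋ {r} {s} r-below s-below (k by r-s≋kQ) = x∙y⁻¹≈ε⇒x≈y r s
    (multiple-of-monic-below≈0 _≟_ k Q-monic (DegreeBelow--P {d} {r} {s} r-below s-below) r-s≋kQ)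

  fromDigits : ∀ {n} → Vec (Fin q) n → Pol
  fromDigits []      = []
  fromDigits (i ∷ v) = enum i ∷ fromDigits v

  digits : ∀ n → Pol → Vec (Fin q) n
  digits zero    p       = []
  digits (suc n) []      = index 0# ∷ digits n []
  digits (suc n) (a ∷ p) = index a ∷ digits n p

  fromDigits-below : ∀ {n} (v : Vec (Fin q) n) → DegreeBelow n (fromDigits v)
  fromDigits-below []      m       _         = refl
  fromDigits-below (i ∷ v) (suc m) (s≤s n≤m) = fromDigits-below v m n≤m

  fromDigits-digits : ∀ n {p} → DegreeBelow n p → fromDigits (digits n p) ≋ p
  fromDigits-digits zero    p-below = ≋-sym (DegreeBelow-0 p-below)
  fromDigits-digits (suc n) {[]}    p-below =
    ≋-trans (∷-cong (enum-index 0#) (fromDigits-digits n (λ _ _ → refl))) 0∷[]≋[]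
  fromDigits-digits (suc n) {a ∷ p} p-below =
    ∷-cong (enum-index a) (fromDigits-digits n (λ m n≤m → p-below (suc m) (s≤s n≤m)))

  fromDigits-injective : ∀ {n} (v w : Vec (Fin q) n) → fromDigits v ≋ fromDigits w → v ≡ w
  fromDigits-injective []      []      _   = ≡.refl
  fromDigits-injective (i ∷ v) (j ∷ w) v≋w =
    ≡.cong₂ _∷_ (enum-inj i j (at v≋w zero)) (fromDigits-injective v w (∷-injectiveʳ v≋w))

  digitCode : Fin (q ℕ.^ d) ↔ Vec (Fin q) d
  digitCode = ↔-trans (Fin[m^n]↔Fin[m]^n q d) (↔Vec d)

  residue : Fin (q ℕ.^ d) → Pol
  residue i = fromDigits (Inverse.to digitCode i)

  divideByQ : ∀ p → DivMod Q p d
  divideByQ = divide {Q} {d} (proj₂ Q-monic) (HasDegree⇒DegreeBelow {Q} {d} (proj₁ Q-monic))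

  reduce : Pol → Pol
  reduce p = DivMod.remainder (divideByQ p)

  ∼-reduce : ∀ p → p ∼ reduce p
  ∼-reduce p with divideByQ p
  ... | divMod h r p≋Qh+r _ =
    h by ≋-trans (+P-cong p≋Qh+r ≋-refl) (≋-trans (//-rightDividesʳ r (Q *P h)) (*P-comm Q h))

  residue-surjective : ∀ x → ∃ λ i → residue i ∼ x
  residue-surjective x = Inverse.from digitCode v , (begin
    fromDigits (Inverse.to digitCode (Inverse.from digitCode v)) ≡⟨ ≡.cong fromDigits (Inverse.strictlyInverseˡ digitCode v) ⟩
    fromDigits v                                                 ≈⟨ ≈⇒∼ (fromDigits-digits d (DivMod.remainder-below (divideByQ x))) ⟩
    reduce x                                                     ≈⟨ K.sym (∼-reduce x) ⟩
    x                                                            ∎)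
    where
    v : Vec (Fin q) d
    v = digits d (reduce x)

  residue-injective : ∀ i j → residue i ∼ residue j → i ≡ j
  residue-injective i j ri∼rj = ≡.trans (≡.sym (Inverse.strictlyInverseʳ digitCode i))
    (≡.trans (≡.cong (Inverse.from digitCode) codes-equal) (Inverse.strictlyInverseʳ digitCode j))
    where
    codes-equal : Inverse.to digitCode i ≡ Inverse.to digitCode j
    codes-equal = fromDigits-injective _ _
      (below-∼⇒≋ (fromDigits-below (Inverse.to digitCode i)) (fromDigits-below (Inverse.to digitCode j)) ri∼rj)

  1∼0⇒Q-unit : oneP ∼ [] → IsUnit Q
  1∼0⇒Q-unit (k by 1≋kQ) = k , at (≋-trans (*P-comm Q k) (≋-sym 1≋kQ))

  constP-*P : ∀ a p → constP a *P p ≋ a ·P p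
  constP-*P a p = ≋-trans (+P-cong (≋-refl {a ·P p}) 0∷[]≋[]) (+P-identityʳ (a ·P p))

  below-factor-unit : ∀ {g h} → DegreeBelow d g → ¬ (g ≋ []) → Q ≋ g *P h → IsUnit g
  below-factor-unit {g} {h} g-below g≉0 Q≋gh with proj₂ (proj₂ Q-irreducible) g h (at Q≋gh)
  ... | inj₁ g-unit       = g-unit
  ... | inj₂ (w , hw≋1)   = contradiction (below-∼⇒≋ g-below (λ _ _ → refl) g∼0) g≉0
    where
    g∼0 : g ∼ []
    g∼0 = begin
      g              ≈⟨ K.*-identityʳ g ⟨
      g *P oneP      ≈⟨ K.*-congˡ {g} (≈⇒∼ (mk hw≋1)) ⟨
      g *P (h *P w)  ≈⟨ K.*-assoc g h w ⟨
      (g *P h) *P w  ≈⟨ K.*-congʳ {w} (≈⇒∼ Q≋gh) ⟨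
      Q *P w         ≈⟨ K.*-congʳ {w} m∼0 ⟩
      [] *P w        ≈⟨ K.zeroˡ w ⟩
      []             ∎

  normalise : ∀ {g e} → HasDegree g e →
              ∃ λ c → coeff (constP c *P g) e ≈ 1# × DegreeBelow (suc e) (constP c *P g)
  normalise {g} {e} g-deg@(lead≉0 , _) with inverse (coeff g e) lead≉0
  ... | c , lead*c≈1 = c , lead≈1 , below
    where
    lead≈1 : coeff (constP c *P g) e ≈ 1#
    lead≈1 = trans (at (constP-*P c g) e) (trans (coeff-·P c g e) (trans (*-comm c _) lead*c≈1))
    below : DegreeBelow (suc e) (constP c *P g)
    below n e<n = trans (at (constP-*P c g) n)
      (trans (coeff-·P c g n) (trans (*-congˡ (HasDegree⇒DegreeBelow {g} {e} g-deg n e<n)) (zeroʳ c)))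

  module _ (a : Pol) where

    unit-multiple⇒invertible : ∀ {g u} → g ∼ u *P a → IsUnit g → ∃ λ b → a *P b ∼ oneP
    unit-multiple⇒invertible {g} {u} g∼ua (w , gw≈1) = u *P w , (begin
      a *P (u *P w)  ≈⟨ K.*-assoc a u w ⟨
      (a *P u) *P w  ≈⟨ K.*-congʳ {w} (K.*-comm a u) ⟩
      (u *P a) *P w  ≈⟨ K.*-congʳ {w} g∼ua ⟨
      g *P w         ≈⟨ ≈⇒∼ (mk gw≈1) ⟩
      oneP           ∎)

    remainder-invariant : ∀ {g u h r} → g ∼ u *P a → Q ≋ g *P h +P r → r ∼ (-P (u *P h)) *P a
    remainder-invariant {g} {u} {h} {r} g∼ua Q≋gh+r = begin
      r                          ≈⟨ ≈⇒∼ (xyx⁻¹≈y (g *P h) r) ⟨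
      (g *P h +P r) -P g *P h    ≈⟨ K.+-congʳ (≈⇒∼ Q≋gh+r) ⟨
      Q -P g *P h                ≈⟨ K.+-congʳ m∼0 ⟩
      [] -P g *P h               ≈⟨ K.-‿cong (K.*-congʳ g∼ua) ⟩
      -P ((u *P a) *P h)         ≈⟨ K.-‿cong (xy∙z≈xz∙y u a h) ⟩
      -P ((u *P h) *P a)         ≈⟨ -‿distribˡ-* (u *P h) a ⟩
      (-P (u *P h)) *P a         ∎
      where
      open import Algebra.Properties.AbelianGroup (CommutativeRing.+-abelianGroup R[T]) using (xyx⁻¹≈y)
      open import Algebra.Properties.CommutativeSemigroup K.*-commutativeSemigroup using (xy∙z≈xz∙y)
      open import Algebra.Properties.Ring K.ring using (-‿distribˡ-*)

    -- Euclid's algorithm on Q and g, keeping g ≡ u a (mod Q): the remainder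
    -- of Q by g has smaller degree, and once it vanishes g divides Q.
    invert-step : ∀ {e} → Acc _<_ e → ∀ g u → HasDegree g e → e < d → g ∼ u *P a → ∃ λ b → a *P b ∼ oneP
    invert-step {e} (acc smaller) g u g-deg e<d g∼ua with normalise {g} {e} g-deg
    ... | c , gm-lead , gm-below = divide-step (divide {gm} {e} gm-lead gm-below Q)
      where
      gm u′ : Pol
      gm = constP c *P g
      u′ = constP c *P u
      gm∼u′a : gm ∼ u′ *P a
      gm∼u′a = K.trans (K.*-congˡ {constP c} g∼ua) (K.sym (K.*-assoc (constP c) u a))
      gm≉0 : ¬ (gm ≋ [])
      gm≉0 gm≋[] = one≉zero (trans (sym gm-lead) (at gm≋[] e))

      divide-step : DivMod gm Q e → ∃ λ b → a *P b ∼ oneP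
      divide-step (divMod h r Q≋gmh+r r-below) with zero-or-degree _≟_ r
      ... | inj₁ r≋[] = unit-multiple⇒invertible {gm} {u′} gm∼u′a
        (below-factor-unit (DegreeBelow-mono {suc e} {d} {gm} e<d gm-below) gm≉0 Q≋gmh)
        where
        Q≋gmh : Q ≋ gm *P h
        Q≋gmh = ≋-trans Q≋gmh+r (≋-trans (+P-cong {gm *P h} ≋-refl r≋[]) (+P-identityʳ (gm *P h)))
      ... | inj₂ (e′ , r-deg) =
        invert-step (smaller e′<e) r (-P (u′ *P h)) r-deg (<-trans e′<e e<d)
          (remainder-invariant {gm} {u′} {h} {r} gm∼u′a Q≋gmh+r)
        where
        e′<e : e′ < e
        e′<e = DegreeBelow⇒< {r} r-below r-deg

    invert : ¬ (a ∼ []) → ∃ λ b → a *P b ∼ oneP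
    invert a≁0 with zero-or-degree _≟_ (reduce a)
    ... | inj₁ ra≋[] = contradiction (K.trans (∼-reduce a) (≈⇒∼ ra≋[])) a≁0
    ... | inj₂ (e , ra-deg) = invert-step (<-wellFounded e) (reduce a) oneP ra-deg
      (DegreeBelow⇒< {reduce a} (DivMod.remainder-below (divideByQ a)) ra-deg)
      (K.trans (K.sym (∼-reduce a)) (K.sym (K.*-identityˡ a)))

  isFiniteField : IsFiniteField R[T]/Q (q ℕ.^ d)
  isFiniteField = record
    { one≉zero  = λ 1∼0 → proj₁ (proj₂ Q-irreducible) (1∼0⇒Q-unit 1∼0)
    ; inverse   = invert
    ; enum      = residue
    ; enum-surj = residue-surjective
    ; enum-inj  = residue-injective
    }

module CarlitzPeriodicity {c ℓ : Level} (R : CommutativeRing c ℓ) (q d : ℕ) (Q : Poly.Pol R) where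
  open Poly R
  open Carlitz q
  open PolynomialRing R using (R[T])
  open PrincipalQuotient R[T] Q renaming (S/m to R[T]/Q)
  open CommutativeRing R[T]/Q hiding (zero)
  open import Algebra.Properties.Semiring.Exp semiring using (_^_; ^-congˡ; ^-assocʳ)
  open import Algebra.Properties.Ring ring using (-‿distribˡ-*; -‿distribʳ-*)
  open import Algebra.Properties.CommutativeSemigroup *-commutativeSemigroup using (x∙yz≈y∙xz)
  open import Relation.Binary.Reasoning.Setoid setoid

  ^P≡^ : ∀ p n → p ^P n ≡ p ^ n
  ^P≡^ p zero    = ≡.refl
  ^P≡^ p (suc n) = ≡.cong (p *P_) (^P≡^ p n)

  F-at-brk-root : ∀ n → brk n ∼ [] → F n ∼ sgn n
  F-at-brk-root zero    _         = refl
  F-at-brk-root (suc n) brk-n∼0 = begin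
    sgn (suc n) +P brk (suc n) *P F n ≈⟨ +-congˡ (*-congʳ brk-n∼0) ⟩
    sgn (suc n) +P [] *P F n          ≈⟨ +-identityʳ (sgn (suc n)) ⟩
    sgn (suc n)                       ∎

  sgn-+ : ∀ m n → sgn (m ℕ.+ n) ∼ sgn m *P sgn n
  sgn-+ zero    n = sym (*-identityˡ (sgn n))
  sgn-+ (suc m) n = trans (-‿cong (sgn-+ m n)) (-‿distribˡ-* (sgn m) (sgn n))

  brk-0 : brk 0 ∼ []
  brk-0 = trans (+-congʳ { -P T} (*-identityʳ T)) (-‿inverseʳ T)

  module _ (T^qᵈ∼T : T ^ (q ℕ.^ d) ∼ T) where

    T^qˢᵈ∼T : ∀ s → T ^ (q ℕ.^ (s ℕ.* d)) ∼ T
    T^qˢᵈ∼T zero    = *-identityʳ T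
    T^qˢᵈ∼T (suc s) = begin
      T ^ (q ℕ.^ (d ℕ.+ s ℕ.* d))             ≡⟨ ≡.cong (T ^_) (ℕ.^-distribˡ-+-* q d (s ℕ.* d)) ⟩
      T ^ (q ℕ.^ d ℕ.* q ℕ.^ (s ℕ.* d))       ≈⟨ ^-assocʳ T (q ℕ.^ d) (q ℕ.^ (s ℕ.* d)) ⟨
      (T ^ (q ℕ.^ d)) ^ (q ℕ.^ (s ℕ.* d))     ≈⟨ ^-congˡ (q ℕ.^ (s ℕ.* d)) T^qᵈ∼T ⟩
      T ^ (q ℕ.^ (s ℕ.* d))                   ≈⟨ T^qˢᵈ∼T s ⟩
      T                                       ∎

    brk-periodic : ∀ s j → brk (s ℕ.* d ℕ.+ j) ∼ brk j
    brk-periodic s j = +-congʳ (begin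
      T ^P (q ℕ.^ (s ℕ.* d ℕ.+ j))            ≡⟨ ^P≡^ T (q ℕ.^ (s ℕ.* d ℕ.+ j)) ⟩
      T ^ (q ℕ.^ (s ℕ.* d ℕ.+ j))             ≡⟨ ≡.cong (T ^_) (ℕ.^-distribˡ-+-* q (s ℕ.* d) j) ⟩
      T ^ (q ℕ.^ (s ℕ.* d) ℕ.* q ℕ.^ j)       ≈⟨ ^-assocʳ T (q ℕ.^ (s ℕ.* d)) (q ℕ.^ j) ⟨
      (T ^ (q ℕ.^ (s ℕ.* d))) ^ (q ℕ.^ j)     ≈⟨ ^-congˡ (q ℕ.^ j) (T^qˢᵈ∼T s) ⟩
      T ^ (q ℕ.^ j)                           ≡⟨ ^P≡^ T (q ℕ.^ j) ⟨
      T ^P (q ℕ.^ j)                          ∎)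

    F-periodic : ∀ s l → F (s ℕ.* d ℕ.+ l) ∼ sgn (s ℕ.* d) *P F l
    F-periodic s zero = begin
      F (s ℕ.* d ℕ.+ 0)     ≡⟨ ≡.cong F (ℕ.+-identityʳ (s ℕ.* d)) ⟩
      F (s ℕ.* d)           ≈⟨ F-at-brk-root (s ℕ.* d) brk-sd∼0 ⟩
      sgn (s ℕ.* d)         ≈⟨ *-identityʳ _ ⟨
      sgn (s ℕ.* d) *P oneP ∎
      where
      brk-sd∼0 : brk (s ℕ.* d) ∼ []
      brk-sd∼0 = trans (reflexive (≡.cong brk (≡.sym (ℕ.+-identityʳ (s ℕ.* d))))) (trans (brk-periodic s 0) brk-0)
    F-periodic s (suc l) = begin
      F (sd ℕ.+ suc l)                                                  ≡⟨ ≡.cong F (ℕ.+-suc sd l) ⟩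
      sgn (suc (sd ℕ.+ l)) +P brk (suc (sd ℕ.+ l)) *P F (sd ℕ.+ l)      ≈⟨ +-cong sgn-shift (*-cong brk-shift (F-periodic s l)) ⟩
      sgn sd *P sgn (suc l) +P brk (suc l) *P (sgn sd *P F l)           ≈⟨ +-congˡ (x∙yz≈y∙xz (brk (suc l)) (sgn sd) (F l)) ⟩
      sgn sd *P sgn (suc l) +P sgn sd *P (brk (suc l) *P F l)           ≈⟨ distribˡ (sgn sd) _ _ ⟨
      sgn sd *P F (suc l)                                               ∎
      where
      sd : ℕ
      sd = s ℕ.* d
      sgn-shift : sgn (suc (sd ℕ.+ l)) ∼ sgn sd *P sgn (suc l)
      sgn-shift = trans (-‿cong (sgn-+ sd l)) (-‿distribʳ-* (sgn sd) (sgn l))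
      brk-shift : brk (suc (sd ℕ.+ l)) ∼ brk (suc l)
      brk-shift = trans (reflexive (≡.cong brk (≡.sym (ℕ.+-suc sd l)))) (brk-periodic s (suc l))

open import Data.Nat using (_+_; _*_)

lemma3p1 : {c ℓ′ : Level} (q : ℕ) (R : CommutativeRing c ℓ′) → IsFiniteField R q →
           let open Poly R in let open Carlitz q in
           (s ℓ d : ℕ) (Q : Pol) → IsPrimePolyOfDegree Q d → ℓ < d →
           F (s * d + ℓ) ≡ sgn (s * d) *P F ℓ mod Q
lemma3p1 q R isFF s ℓ d Q Q-prime _ = quotient congruence , at (difference congruence)
  where
  open PolynomialRing R using (R[T]; at)
  open PrincipalQuotient R[T] Q using (_∼_; quotient; difference) renaming (S/m to R[T]/Q)
  open ResidueField q R isFF d Q Q-prime using (isFiniteField)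
  open FiniteField R[T]/Q isFiniteField using (fermat)
  open Poly R using (T; sgn; _*P_; module Carlitz)
  open Carlitz q using (F)
  congruence : F (s * d + ℓ) ∼ sgn (s * d) *P F ℓ
  congruence = CarlitzPeriodicity.F-periodic R q d Q (fermat T) s ℓ
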